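{- Let $T$ be a tournament and $k\ge 0$ an integer, let $A'\subseteq A(T)$ be a DESC-set of $T$ with $|A'|\le k$, and let $T'=T-A'$. If vertices $x$ and $y$ belong to the same strong component of $T'$, then $|d^+_T(x)-d^+_T(y)|\le k$.
   Context: $d^+_T(x)$ is the out-degree of $x$ in $T$. A digraph is Eulerian iff it is strongly connected and balanced (every vertex has equal in- and out-degree); a single vertex counts as strongly connected. $T-A'$ denotes $T$ with the arcs of $A'$ deleted. A set $A'\subseteq A(T)$ is a DESC-set if every strong component of $T-A'$ is Eulerian. -}

module Defs where

open import Data.Nat using (ℕ; zero; suc)
open import Data.Bool using (Bool; true; false; _∧_; _∨_; not)
open import Data.Fin using (Fin)
open import Data.List using (List; length; filterᵇ; map)
open import Data.Bool.ListAction using (any)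
open import Data.Nat.ListAction using (sum)
open import Relation.Nullary using (does)
open import Data.List using (allFin)
open import Relation.Binary.PropositionalEquality using (_≡_)
open import Relation.Nullary using (¬_)

-- A digraph (without multiple arcs) on the vertex set Fin n,
-- given by its Boolean adjacency relation: G x y = true iff x → y is an arc.
Digraph : ℕ → Set
Digraph n = Fin n → Fin n → Bool

countV : ∀ {n} → (Fin n → Bool) → ℕ
countV {n} P = length (filterᵇ P (allFin n))

numArcs : ∀ {n} → Digraph n → ℕ
numArcs {n} G = sum (map (λ x → countV (G x)) (allFin n))

outdeg : ∀ {n} → Digraph n → Fin n → ℕ
outdeg G x = countV (G x)

indeg : ∀ {n} → Digraph n → Fin n → ℕ
indeg G x = countV (λ y → G y x)

reachWithin : ∀ {n} → Digraph n → ℕ → Fin n → Fin n → Bool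
reachWithin G zero    x y = does (x Data.Fin.≟ y)
reachWithin {n} G (suc k) x y =
  reachWithin G k x y ∨ any (λ z → reachWithin G k x z ∧ G z y) (allFin n)

-- Reachability (on n vertices, walks of length ≤ n suffice).
reach : ∀ {n} → Digraph n → Fin n → Fin n → Bool
reach {n} G x y = reachWithin G n x y

sameComp : ∀ {n} → Digraph n → Fin n → Fin n → Bool
sameComp G x y = reach G x y ∧ reach G y x

-- A digraph with vertex set S ⊆ Fin n (arcs of H assumed inside S)
-- is Eulerian iff strongly connected and balanced.
Eulerian : ∀ {n} → (S : Fin n → Bool) → Digraph n → Set
Eulerian {n} S H =
  (∀ (u w : Fin n) → S u ≡ true → S w ≡ true → reach H u w ≡ true)
  × (∀ (u : Fin n) → S u ≡ true → outdeg H u ≡ indeg H u)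
  where open import Data.Product using (_×_)

compVerts : ∀ {n} → Digraph n → Fin n → Fin n → Bool
compVerts G v = sameComp G v

compArcs : ∀ {n} → Digraph n → Fin n → Digraph n
compArcs G v u w = G u w ∧ sameComp G v u ∧ sameComp G v w

IsTournament : ∀ {n} → Digraph n → Set
IsTournament {n} T =
  (∀ (x : Fin n) → T x x ≡ false)
  × (∀ (x y : Fin n) → ¬ (x ≡ y) → T y x ≡ not (T x y))
  where open import Data.Product using (_×_)

_⊆A_ : ∀ {n} → Digraph n → Digraph n → Set
_⊆A_ {n} A' T = ∀ (x y : Fin n) → A' x y ≡ true → T x y ≡ true

_-A_ : ∀ {n} → Digraph n → Digraph n → Digraph n
(T -A A') x y = T x y ∧ not (A' x y)

IsDESC : ∀ {n} → Digraph n → Digraph n → Set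
IsDESC {n} T A' =
  A' ⊆A T × (∀ (v : Fin n) → Eulerian (compVerts (T -A A') v) (compArcs (T -A A') v))
  where open import Data.Product using (_×_)

-- In a tournament out(v) + in(v) = n − 1, so it suffices to show
-- out(x) + in(y) ≤ in(x) + out(y) + 2|A'|.  Let H be the common strong
-- component of x and y in T − A', and compare, vertex by vertex, the arcs
-- x → z, z → y of T with the arcs z → x, y → z.  If z ∈ H, an arc x → z or
-- z → y of T is an arc of H unless it lies in A'.  If z ∉ H, the path
-- x → z → y cannot survive in T − A', since it would put z into H; so one of
-- its arcs lies in A'.  Summing over z, the arcs of H at x and at y cancel
-- because H is balanced, and the arcs of A' at x or y are paid for at most
-- twice.
module Submission where

open import Defs
open import Data.Bool using (Bool; true; false; _∧_; _∨_; not)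
open import Data.Bool.ListAction using (any)
open import Data.Bool.Properties using (∧-identityʳ; ∧-zeroʳ; ∨-zeroʳ; T-≡; ¬-not)
  renaming (_≟_ to _≟ᵇ_)
open import Data.Empty using (⊥-elim)
open import Data.Fin using (Fin; zero; suc; punchIn; _≟_)
open import Data.Fin.Properties using (punchInᵢ≢i; any?)
open import Data.List using (length; filterᵇ; tabulate; allFin)
open import Data.List.Membership.Propositional using (lose)
open import Data.List.Membership.Propositional.Properties using (∈-allFin)
open import Data.List.Properties using (map-tabulate)
open import Data.List.Relation.Unary.Any using (satisfied)
open import Data.List.Relation.Unary.Any.Properties using (any⁺; any⁻)
open import Data.Nat using (ℕ; zero; suc; _+_; _*_; _≤_; _<_; z≤n; s≤s; ∣_-_∣)
open import Data.Nat.ListAction using () renaming (sum to listSum)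
open import Data.Nat.Properties
  using ( ≤-refl; ≤-reflexive; ≤-trans; <⇒≱; n<1+n; m≤m+n; +-identityʳ; *-identityˡ
        ; +-mono-≤; +-monoʳ-≤; *-monoʳ-≤; +-cancelʳ-≤; *-cancelˡ-≤; suc-injective
        ; ∣m-n∣≡[m∸n]∨[n∸m]; m≤n+o⇒m∸n≤o; +-*-semiring; module ≤-Reasoning)
open import Algebra.Properties.Semiring.Sum +-*-semiring
  using (sum; sum-cong-≗; sum-remove; ∑-distrib-+; *-distribˡ-sum; sum-replicate-zero)
open import Data.Nat.Tactic.RingSolver using (solve-∀)
open import Data.Product using (_×_; _,_; proj₁; proj₂; ∃-syntax)
open import Data.Sum using (_⊎_; inj₁; inj₂)
open import Function using (_∘_; Equivalence)
open import Relation.Nullary using (¬_; yes; no; does)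
open import Relation.Nullary.Decidable using (dec-true; dec-false; _×-dec_)
open import Relation.Binary.PropositionalEquality

𝟙 : Bool → ℕ
𝟙 true  = 1
𝟙 false = 0

δ : ∀ {n} → Fin n → Fin n → ℕ
δ u v = 𝟙 (does (u ≟ v))

𝟙≤1 : ∀ b → 𝟙 b ≤ 1
𝟙≤1 true  = s≤s z≤n
𝟙≤1 false = z≤n

𝟙-mono : ∀ {p q} → (p ≡ true → q ≡ true) → 𝟙 p ≤ 𝟙 q
𝟙-mono {false} _   = z≤n
𝟙-mono {true}  p⇒q rewrite p⇒q refl = ≤-refl

𝟙-∧ˡ : ∀ p q → 𝟙 (p ∧ q) ≤ 𝟙 p
𝟙-∧ˡ true  q = 𝟙≤1 q
𝟙-∧ˡ false q = z≤n

𝟙-removal : ∀ {t r} → (r ≡ true → t ≡ true) → 𝟙 t ≡ 𝟙 (t ∧ not r) + 𝟙 r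
𝟙-removal {t} {false} _   = trans (cong 𝟙 (sym (∧-identityʳ t))) (sym (+-identityʳ _))
𝟙-removal {t} {true}  r⇒t rewrite r⇒t refl = refl

δ-≢ : ∀ {n} {u v : Fin n} → u ≢ v → δ u v ≡ 0
δ-≢ {u = u} {v} u≢v = cong 𝟙 (dec-false (u ≟ v) u≢v)

∧-true : ∀ {p q} → p ∧ q ≡ true → p ≡ true × q ≡ true
∧-true {true} q = refl , q

false≢true : false ≢ true
false≢true ()

sum-mono-≤ : ∀ {n} {f g : Fin n → ℕ} → (∀ i → f i ≤ g i) → sum f ≤ sum g
sum-mono-≤ {zero}  _   = z≤n
sum-mono-≤ {suc n} f≤g = +-mono-≤ (f≤g zero) (sum-mono-≤ (f≤g ∘ suc))

sum-ones : ∀ n → sum {n} (λ _ → 1) ≡ n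
sum-ones zero    = refl
sum-ones (suc n) = cong suc (sum-ones n)

term≤sum : ∀ {n} (f : Fin n → ℕ) i → f i ≤ sum f
term≤sum {suc n} f i = ≤-trans (m≤m+n (f i) _) (≤-reflexive (sym (sum-remove {i = i} f)))

sum-δ : ∀ {n} (v : Fin n) c → sum (λ z → δ z v * c) ≡ c
sum-δ {suc n} zero    c =
  trans (cong (c + 0 +_) (sum-replicate-zero n)) (trans (+-identityʳ _) (+-identityʳ c))
sum-δ {suc n} (suc v) c = sum-δ v c

sum-𝟙≤ : ∀ {n} (P : Fin n → Bool) → sum (𝟙 ∘ P) ≤ n
sum-𝟙≤ {n} P = ≤-trans (sum-mono-≤ (𝟙≤1 ∘ P)) (≤-reflexive (sum-ones n))

sum-𝟙-< : ∀ {n} {P Q : Fin n → Bool} → (∀ i → P i ≡ true → Q i ≡ true) →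
          ∀ w → P w ≡ false → Q w ≡ true → sum (𝟙 ∘ P) < sum (𝟙 ∘ Q)
sum-𝟙-< {suc n} {P} {Q} P⇒Q w Pw Qw = begin-strict
    sum (𝟙 ∘ P)
  ≡⟨ sum-remove {i = w} (𝟙 ∘ P) ⟩
    𝟙 (P w) + sum (𝟙 ∘ P ∘ punchIn w)
  ≡⟨ cong (λ b → 𝟙 b + sum (𝟙 ∘ P ∘ punchIn w)) Pw ⟩
    sum (𝟙 ∘ P ∘ punchIn w)
  ≤⟨ sum-mono-≤ (λ j → 𝟙-mono (P⇒Q (punchIn w j))) ⟩
    sum (𝟙 ∘ Q ∘ punchIn w)
  <⟨ n<1+n _ ⟩
    1 + sum (𝟙 ∘ Q ∘ punchIn w)
  ≡⟨ cong (λ b → 𝟙 b + sum (𝟙 ∘ Q ∘ punchIn w)) Qw ⟨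
    𝟙 (Q w) + sum (𝟙 ∘ Q ∘ punchIn w)
  ≡⟨ sum-remove {i = w} (𝟙 ∘ Q) ⟨
    sum (𝟙 ∘ Q)
  ∎ where open ≤-Reasoning

length-filterᵇ-tabulate : ∀ {a} {A : Set a} {n} (P : A → Bool) (f : Fin n → A) →
                          length (filterᵇ P (tabulate f)) ≡ sum (𝟙 ∘ P ∘ f)
length-filterᵇ-tabulate {n = zero}  P f = refl
length-filterᵇ-tabulate {n = suc n} P f with P (f zero)
... | true  = cong suc (length-filterᵇ-tabulate P (f ∘ suc))
... | false = length-filterᵇ-tabulate P (f ∘ suc)

listSum-tabulate : ∀ {n} (f : Fin n → ℕ) → listSum (tabulate f) ≡ sum f
listSum-tabulate {zero}  f = refl
listSum-tabulate {suc n} f = cong (f zero +_) (listSum-tabulate (f ∘ suc))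

countV≡sum : ∀ {n} (P : Fin n → Bool) → countV P ≡ sum (𝟙 ∘ P)
countV≡sum P = length-filterᵇ-tabulate P (λ i → i)

numArcs≡sum : ∀ {n} (G : Digraph n) → numArcs G ≡ sum (outdeg G)
numArcs≡sum G = trans (cong listSum (map-tabulate (λ i → i) (outdeg G))) (listSum-tabulate (outdeg G))

outdeg+indeg≤numArcs : ∀ {n} (A : Digraph n) x y → outdeg A x + indeg A y ≤ numArcs A + 𝟙 (A x y)
outdeg+indeg≤numArcs {suc n} A x y = begin
    outdeg A x + indeg A y
  ≡⟨ cong (outdeg A x +_) (trans (countV≡sum (λ u → A u y)) (sum-remove {i = x} (λ u → 𝟙 (A u y)))) ⟩
    outdeg A x + (𝟙 (A x y) + sum (λ j → 𝟙 (A (punchIn x j) y)))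
  ≤⟨ +-monoʳ-≤ (outdeg A x) (+-monoʳ-≤ (𝟙 (A x y)) (sum-mono-≤ arc≤outdeg)) ⟩
    outdeg A x + (𝟙 (A x y) + sum (outdeg A ∘ punchIn x))
  ≡⟨ regroup (outdeg A x) (𝟙 (A x y)) (sum (outdeg A ∘ punchIn x)) ⟩
    outdeg A x + sum (outdeg A ∘ punchIn x) + 𝟙 (A x y)
  ≡⟨ cong (_+ 𝟙 (A x y)) (trans (numArcs≡sum A) (sum-remove {i = x} (outdeg A))) ⟨
    numArcs A + 𝟙 (A x y)
  ∎ where
  open ≤-Reasoning
  arc≤outdeg : ∀ j → 𝟙 (A (punchIn x j) y) ≤ outdeg A (punchIn x j)
  arc≤outdeg j =
    ≤-trans (term≤sum (𝟙 ∘ A (punchIn x j)) y) (≤-reflexive (sym (countV≡sum (A (punchIn x j)))))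
  regroup : ∀ d a r → d + (a + r) ≡ d + r + a
  regroup = solve-∀

outdeg+indeg-tournament : ∀ {n} {T : Digraph n} → IsTournament T → ∀ v → suc (outdeg T v + indeg T v) ≡ n
outdeg+indeg-tournament {suc n} {T} (loopless , flip) v = cong suc (begin
    outdeg T v + indeg T v
  ≡⟨ cong₂ _+_ (countV≡sum (T v)) (countV≡sum (λ u → T u v)) ⟩
    sum (λ u → 𝟙 (T v u)) + sum (λ u → 𝟙 (T u v))
  ≡⟨ ∑-distrib-+ (λ u → 𝟙 (T v u)) (λ u → 𝟙 (T u v)) ⟨
    sum (λ u → 𝟙 (T v u) + 𝟙 (T u v))
  ≡⟨ sum-remove {i = v} (λ u → 𝟙 (T v u) + 𝟙 (T u v)) ⟩
    𝟙 (T v v) + 𝟙 (T v v) + sum (λ j → 𝟙 (T v (punchIn v j)) + 𝟙 (T (punchIn v j) v))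
  ≡⟨ cong₂ _+_ (cong (λ b → 𝟙 b + 𝟙 b) (loopless v))
               (sum-cong-≗ (λ j → exactly-one (punchIn v j) (punchInᵢ≢i v j))) ⟩
    sum {n} (λ _ → 1)
  ≡⟨ sum-ones n ⟩
    n
  ∎)
  where
  open ≡-Reasoning
  exactly-one : ∀ u → u ≢ v → 𝟙 (T v u) + 𝟙 (T u v) ≡ 1
  exactly-one u u≢v rewrite flip v u (u≢v ∘ sym) with T v u
  ... | true  = refl
  ... | false = refl

any-allFin⁺ : ∀ {n} (p : Fin n → Bool) w → p w ≡ true → any p (allFin n) ≡ true
any-allFin⁺ p w pw =
  Equivalence.to T-≡ (any⁺ p (lose (∈-allFin w) (Equivalence.from T-≡ pw)))

any-allFin⁻ : ∀ {n} (p : Fin n → Bool) → any p (allFin n) ≡ true → ∃[ w ] p w ≡ true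
any-allFin⁻ {n} p h with satisfied (any⁻ p (allFin n) (Equivalence.from T-≡ h))
... | w , pw = w , Equivalence.to T-≡ pw

module _ {n} (G : Digraph n) where

  reachWithin-suc : ∀ {k x y} → reachWithin G k x y ≡ true → reachWithin G (suc k) x y ≡ true
  reachWithin-suc h rewrite h = refl

  reachWithin-refl : ∀ k x → reachWithin G k x x ≡ true
  reachWithin-refl zero    x = dec-true (x ≟ x) refl
  reachWithin-refl (suc k) x = reachWithin-suc {k} (reachWithin-refl k x)

  reachWithin-snoc : ∀ {k x w y} → reachWithin G k x w ≡ true → G w y ≡ true →
                     reachWithin G (suc k) x y ≡ true
  reachWithin-snoc {k} {x} {w} {y} xw wy =
    trans (cong (reachWithin G k x y ∨_) (any-allFin⁺ _ w (trans (cong (_∧ G w y) xw) wy)))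
          (∨-zeroʳ _)

  reachWithin-suc⁻ : ∀ {k x y} → reachWithin G (suc k) x y ≡ true →
                     reachWithin G k x y ≡ true ⊎ ∃[ w ] (reachWithin G k x w ≡ true × G w y ≡ true)
  reachWithin-suc⁻ {k} {x} {y} h with reachWithin G k x y
  ... | true  = inj₁ refl
  ... | false with any-allFin⁻ _ h
  ...   | w , xwy = inj₂ (w , ∧-true xwy)

  reachWithin-cons : ∀ {k z y x} → G z y ≡ true → reachWithin G k y x ≡ true →
                     reachWithin G (suc k) z x ≡ true
  reachWithin-cons {zero} {z} {y} {x} zy yx with y ≟ x
  ... | yes refl = reachWithin-snoc {zero} {z} {z} (reachWithin-refl zero z) zy
  reachWithin-cons {suc k} zy yx with reachWithin-suc⁻ {k} yx
  ... | inj₁ yx′           = reachWithin-suc {suc k} (reachWithin-cons {k} zy yx′)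
  ... | inj₂ (w , yw , wx) = reachWithin-snoc {suc k} (reachWithin-cons {k} zy yw) wx

  Stable : ℕ → Fin n → Set
  Stable k x = ∀ y → reachWithin G (suc k) x y ≡ true → reachWithin G k x y ≡ true

  stable-suc : ∀ {k x} → Stable k x → Stable (suc k) x
  stable-suc {k} st y h with reachWithin-suc⁻ {suc k} h
  ... | inj₁ h′            = h′
  ... | inj₂ (w , xw , wy) = reachWithin-snoc {k} (st w xw) wy

  stable-or-growing : ∀ k x → Stable k x ⊎ k < sum (𝟙 ∘ reachWithin G k x)
  stable-or-growing zero x =
    inj₂ (subst (_≤ sum (𝟙 ∘ reachWithin G zero x)) (cong 𝟙 (reachWithin-refl zero x))
                (term≤sum (𝟙 ∘ reachWithin G zero x) x))
  stable-or-growing (suc k) x with stable-or-growing k x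
  ... | inj₁ st = inj₁ (stable-suc {k} st)
  ... | inj₂ k<size
    with any? (λ y → (reachWithin G k x y ≟ᵇ false) ×-dec (reachWithin G (suc k) x y ≟ᵇ true))
  ...   | yes (y , old , new) =
    inj₂ (≤-trans (s≤s k<size) (sum-𝟙-< (λ _ → reachWithin-suc {k}) y old new))
  ...   | no nothing-new = inj₁ (stable-suc {k} stable)
    where
    stable : Stable k x
    stable y new with reachWithin G k x y ≟ᵇ true
    ... | yes old          = old
    ... | no  new-at-suc-k = ⊥-elim (nothing-new (y , ¬-not new-at-suc-k , new))

  reachWithin-saturated : ∀ x y → reachWithin G (suc n) x y ≡ true → reachWithin G n x y ≡ true
  reachWithin-saturated x y with stable-or-growing n x
  ... | inj₁ st     = st y
  ... | inj₂ n<size = ⊥-elim (<⇒≱ n<size (sum-𝟙≤ (reachWithin G n x)))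

  reach-arc : ∀ {x y} → G x y ≡ true → reach G x y ≡ true
  reach-arc {x} {y} xy = reachWithin-saturated x y (reachWithin-cons {n} xy (reachWithin-refl n y))

  reach-cons : ∀ {z y x} → G z y ≡ true → reach G y x ≡ true → reach G z x ≡ true
  reach-cons {z} {y} {x} zy yx = reachWithin-saturated z x (reachWithin-cons {n} zy yx)

  sameComp-refl : ∀ x → sameComp G x x ≡ true
  sameComp-refl x rewrite reachWithin-refl n x = refl

  sameComp-sym : ∀ {x y} → sameComp G x y ≡ true → sameComp G y x ≡ true
  sameComp-sym {x} {y} h with ∧-true {reach G x y} h
  ... | xy , yx = cong₂ _∧_ yx xy

  sameComp-midpoint : ∀ {x y z} → sameComp G x y ≡ true → G x z ≡ true → G z y ≡ true →
                      sameComp G x z ≡ true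
  sameComp-midpoint {x} {y} xy xz zy =
    cong₂ _∧_ (reach-arc xz) (reach-cons zy (proj₂ (∧-true {reach G x y} xy)))

module _ {n} (G : Digraph n) {v u w : Fin n} where

  compArcs-inside : sameComp G v u ≡ true → sameComp G v w ≡ true → compArcs G v u w ≡ G u w
  compArcs-inside vu vw rewrite vu | vw = ∧-identityʳ (G u w)

  compArcs-outsideˡ : sameComp G v u ≡ false → compArcs G v u w ≡ false
  compArcs-outsideˡ vu rewrite vu = ∧-zeroʳ (G u w)

  compArcs-outsideʳ : sameComp G v w ≡ false → compArcs G v u w ≡ false
  compArcs-outsideʳ vw rewrite vw = trans (cong (G u w ∧_) (∧-zeroʳ (sameComp G v u))) (∧-zeroʳ (G u w))

-- The four Booleans are T x z, T y z, A' x z, A' z y for a vertex z outside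
-- the component, where T z x = not (T x z) and T z y = not (T y z).
detour-bound : ∀ txz tyz axz azy → ¬ (txz ∧ not axz ≡ true × not tyz ∧ not azy ≡ true) →
               𝟙 txz + 𝟙 (not tyz) ≤ 𝟙 (not txz) + 𝟙 tyz + 2 * (𝟙 axz + 𝟙 azy)
detour-bound false tyz   _     _     _      = ≤-trans (𝟙≤1 (not tyz)) (s≤s z≤n)
detour-bound true  true  _     _     _      = s≤s z≤n
detour-bound true  false true  true  _      = s≤s (s≤s z≤n)
detour-bound true  false true  false _      = s≤s (s≤s z≤n)
detour-bound true  false false true  _      = s≤s (s≤s z≤n)
detour-bound true  false false false no-way = ⊥-elim (no-way (refl , refl))

half-bound : ∀ {p q r s m} → p + s ≤ q + r + 2 * m → p + q ≡ r + s → p ≤ r + m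
half-bound {p} {q} {r} {s} {m} ps≤qr+2m pq≡rs = *-cancelˡ-≤ 2 (+-cancelʳ-≤ (q + s) _ _ (begin
    2 * p + (q + s)          ≡⟨ regroupˡ p q s ⟩
    p + s + (p + q)          ≤⟨ +-mono-≤ ps≤qr+2m (≤-reflexive pq≡rs) ⟩
    q + r + 2 * m + (r + s)  ≡⟨ regroupʳ q r s m ⟩
    2 * (r + m) + (q + s)    ∎))
  where
  open ≤-Reasoning
  regroupˡ : ∀ p q s → 2 * p + (q + s) ≡ p + s + (p + q)
  regroupˡ = solve-∀
  regroupʳ : ∀ q r s m → q + r + 2 * m + (r + s) ≡ 2 * (r + m) + (q + s)
  regroupʳ = solve-∀

module SameComponent {n} (T A' : Digraph n) (tournament : IsTournament T) (desc : IsDESC T A')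
                     {x y : Fin n} (x~y : sameComp (T -A A') x y ≡ true) where

  G H : Digraph n
  G = T -A A'
  H = compArcs G x

  a : ℕ
  a = 𝟙 (A' x y)

  removed : Fin n → ℕ
  removed z = 𝟙 (A' x z) + 𝟙 (A' z y)

  -- The endpoint terms pay back the arc x → y, which the right-hand side
  -- charges both at z = x and at z = y.
  lhs rhs : Fin n → ℕ
  lhs z = 𝟙 (T x z) + 𝟙 (T z y) + (𝟙 (H z x) + 𝟙 (H y z) + (δ z x * a + δ z y * a))
  rhs z = 𝟙 (T z x) + 𝟙 (T y z) + (𝟙 (H x z) + 𝟙 (H z y) + 2 * removed z)

  x~x : sameComp G x x ≡ true
  x~x = sameComp-refl G x

  A'⊆T : A' ⊆A T
  A'⊆T = proj₁ desc

  A'-loopless : ∀ u → A' u u ≡ false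
  A'-loopless u with A' u u in uu
  ... | false = refl
  ... | true  = ⊥-elim (false≢true (trans (sym (proj₁ tournament u)) (A'⊆T u u uu)))

  endpoints≤removed : ∀ z → δ z x * a + δ z y * a ≤ removed z
  endpoints≤removed z with z ≟ x | z ≟ y
  ... | yes refl | yes refl = ≤-reflexive (cong₂ _+_ (*-identityˡ a) (*-identityˡ a))
  ... | yes refl | no _ rewrite A'-loopless z = ≤-reflexive (trans (+-identityʳ _) (+-identityʳ _))
  ... | no _ | yes refl rewrite A'-loopless z = ≤-reflexive (trans (+-identityʳ _) (sym (+-identityʳ _)))
  ... | no _ | no _ = z≤n

  𝟙H≤𝟙T : ∀ u v → 𝟙 (H u v) ≤ 𝟙 (T u v)
  𝟙H≤𝟙T u v = ≤-trans (𝟙-∧ˡ (G u v) _) (𝟙-∧ˡ (T u v) _)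

  lhs≤rhs-inside : ∀ z → sameComp G x z ≡ true → lhs z ≤ rhs z
  lhs≤rhs-inside z x~z = begin
      lhs z
    ≡⟨ cong (_+ (𝟙 (H z x) + 𝟙 (H y z) + (δ z x * a + δ z y * a)))
            (cong₂ _+_ (𝟙-removal (A'⊆T x z)) (𝟙-removal (A'⊆T z y))) ⟩
      (𝟙 (G x z) + 𝟙 (A' x z)) + (𝟙 (G z y) + 𝟙 (A' z y)) + (𝟙 (H z x) + 𝟙 (H y z) + (δ z x * a + δ z y * a))
    ≤⟨ +-monoʳ-≤ ((𝟙 (G x z) + 𝟙 (A' x z)) + (𝟙 (G z y) + 𝟙 (A' z y)))
         (+-mono-≤ (+-mono-≤ (𝟙H≤𝟙T z x) (𝟙H≤𝟙T y z)) (endpoints≤removed z)) ⟩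
      (𝟙 (G x z) + 𝟙 (A' x z)) + (𝟙 (G z y) + 𝟙 (A' z y)) + (𝟙 (T z x) + 𝟙 (T y z) + removed z)
    ≡⟨ regroup (𝟙 (G x z)) (𝟙 (A' x z)) (𝟙 (G z y)) (𝟙 (A' z y)) (𝟙 (T z x)) (𝟙 (T y z)) ⟩
      𝟙 (T z x) + 𝟙 (T y z) + (𝟙 (G x z) + 𝟙 (G z y) + 2 * removed z)
    ≡⟨ cong (λ h → 𝟙 (T z x) + 𝟙 (T y z) + (h + 2 * removed z))
            (cong₂ _+_ (cong 𝟙 (compArcs-inside G x~x x~z)) (cong 𝟙 (compArcs-inside G x~z x~y))) ⟨
      rhs z
    ∎ where
    open ≤-Reasoning
    regroup : ∀ g a g′ a′ t t′ →
              (g + a) + (g′ + a′) + (t + t′ + (a + a′)) ≡ t + t′ + (g + g′ + 2 * (a + a′))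
    regroup = solve-∀

  lhs≤rhs-outside : ∀ z → sameComp G x z ≡ false → lhs z ≤ rhs z
  lhs≤rhs-outside z x≁z = begin
      lhs z
    ≡⟨ cong₂ _+_ (cong (λ t → 𝟙 (T x z) + 𝟙 t) (proj₂ tournament y z y≢z)) no-H-no-endpoints ⟩
      𝟙 (T x z) + 𝟙 (not (T y z)) + 0
    ≡⟨ +-identityʳ _ ⟩
      𝟙 (T x z) + 𝟙 (not (T y z))
    ≤⟨ detour-bound (T x z) (T y z) (A' x z) (A' z y) no-detour ⟩
      𝟙 (not (T x z)) + 𝟙 (T y z) + 2 * removed z
    ≡⟨ cong₂ _+_ (cong (λ t → 𝟙 t + 𝟙 (T y z)) (proj₂ tournament x z x≢z)) no-H ⟨
      rhs z
    ∎ where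
    open ≤-Reasoning
    x≢z : x ≢ z
    x≢z refl = false≢true (trans (sym x≁z) x~x)
    y≢z : y ≢ z
    y≢z refl = false≢true (trans (sym x≁z) x~y)
    no-H-no-endpoints : 𝟙 (H z x) + 𝟙 (H y z) + (δ z x * a + δ z y * a) ≡ 0
    no-H-no-endpoints rewrite compArcs-outsideˡ G {w = x} x≁z | compArcs-outsideʳ G {u = y} x≁z
                            | δ-≢ (x≢z ∘ sym) | δ-≢ (y≢z ∘ sym) = refl
    no-H : 𝟙 (H x z) + 𝟙 (H z y) + 2 * removed z ≡ 2 * removed z
    no-H rewrite compArcs-outsideʳ G {u = x} x≁z | compArcs-outsideˡ G {w = y} x≁z = refl
    no-detour : ¬ (T x z ∧ not (A' x z) ≡ true × not (T y z) ∧ not (A' z y) ≡ true)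
    no-detour (xz , zy) = false≢true (trans (sym x≁z) (sameComp-midpoint G x~y xz zy′))
      where
      zy′ : G z y ≡ true
      zy′ = trans (cong (_∧ not (A' z y)) (proj₂ tournament y z y≢z)) zy

  lhs≤rhs : ∀ z → lhs z ≤ rhs z
  lhs≤rhs z with sameComp G x z ≟ᵇ true
  ... | yes x~z = lhs≤rhs-inside z x~z
  ... | no  x≁z = lhs≤rhs-outside z (¬-not x≁z)

  sum-lhs≤sum-rhs :
    outdeg T x + indeg T y + (indeg H x + outdeg H y + (a + a)) ≤
    indeg T x + outdeg T y + (outdeg H x + indeg H y + 2 * (outdeg A' x + indeg A' y))
  sum-lhs≤sum-rhs = begin
      outdeg T x + indeg T y + (indeg H x + outdeg H y + (a + a))
    ≡⟨ sum-lhs ⟨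
      sum lhs
    ≤⟨ sum-mono-≤ lhs≤rhs ⟩
      sum rhs
    ≡⟨ sum-rhs ⟩
      indeg T x + outdeg T y + (outdeg H x + indeg H y + 2 * (outdeg A' x + indeg A' y))
    ∎ where
    open ≤-Reasoning
    sum-+₃ : (f g h : Fin n → ℕ) → sum (λ z → f z + (g z + h z)) ≡ sum f + (sum g + sum h)
    sum-+₃ f g h = trans (∑-distrib-+ f (λ z → g z + h z)) (cong (sum f +_) (∑-distrib-+ g h))
    sum-pair : (P Q : Fin n → Bool) → sum (λ z → 𝟙 (P z) + 𝟙 (Q z)) ≡ countV P + countV Q
    sum-pair P Q = trans (∑-distrib-+ (𝟙 ∘ P) (𝟙 ∘ Q)) (sym (cong₂ _+_ (countV≡sum P) (countV≡sum Q)))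
    sum-lhs : sum lhs ≡ outdeg T x + indeg T y + (indeg H x + outdeg H y + (a + a))
    sum-lhs = trans (sum-+₃ (λ z → 𝟙 (T x z) + 𝟙 (T z y)) (λ z → 𝟙 (H z x) + 𝟙 (H y z))
                            (λ z → δ z x * a + δ z y * a))
      (cong₂ _+_ (sum-pair (T x) (λ z → T z y))
      (cong₂ _+_ (sum-pair (λ z → H z x) (H y))
      (trans (∑-distrib-+ (λ z → δ z x * a) (λ z → δ z y * a)) (cong₂ _+_ (sum-δ x a) (sum-δ y a)))))
    sum-rhs : sum rhs ≡ indeg T x + outdeg T y + (outdeg H x + indeg H y + 2 * (outdeg A' x + indeg A' y))
    sum-rhs = trans (sum-+₃ (λ z → 𝟙 (T z x) + 𝟙 (T y z)) (λ z → 𝟙 (H x z) + 𝟙 (H z y))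
                            (λ z → 2 * removed z))
      (cong₂ _+_ (sum-pair (λ z → T z x) (T y))
      (cong₂ _+_ (sum-pair (H x) (λ z → H z y))
      (trans (sym (*-distribˡ-sum 2 removed)) (cong (2 *_) (sum-pair (A' x) (λ z → A' z y))))))

  outdeg+indeg≤indeg+outdeg : outdeg T x + indeg T y ≤ indeg T x + outdeg T y + 2 * numArcs A'
  outdeg+indeg≤indeg+outdeg = +-cancelʳ-≤ (indeg H x + outdeg H y + (a + a)) _ _ (begin
      outdeg T x + indeg T y + (indeg H x + outdeg H y + (a + a))
    ≤⟨ sum-lhs≤sum-rhs ⟩
      indeg T x + outdeg T y + (outdeg H x + indeg H y + 2 * (outdeg A' x + indeg A' y))
    ≤⟨ +-monoʳ-≤ (indeg T x + outdeg T y) (+-monoʳ-≤ (outdeg H x + indeg H y)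
         (*-monoʳ-≤ 2 (outdeg+indeg≤numArcs A' x y))) ⟩
      indeg T x + outdeg T y + (outdeg H x + indeg H y + 2 * (numArcs A' + a))
    ≡⟨ cong (λ h → indeg T x + outdeg T y + (h + 2 * (numArcs A' + a)))
            (cong₂ _+_ (balanced x x~x) (sym (balanced y x~y))) ⟩
      indeg T x + outdeg T y + (indeg H x + outdeg H y + 2 * (numArcs A' + a))
    ≡⟨ regroup (indeg T x + outdeg T y) (indeg H x + outdeg H y) (numArcs A') a ⟩
      indeg T x + outdeg T y + 2 * numArcs A' + (indeg H x + outdeg H y + (a + a))
    ∎)
    where
    open ≤-Reasoning
    balanced : ∀ u → sameComp G x u ≡ true → outdeg H u ≡ indeg H u
    balanced = proj₂ (proj₂ desc x)
    regroup : ∀ d h m a → d + (h + 2 * (m + a)) ≡ d + 2 * m + (h + (a + a))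
    regroup = solve-∀

  outdeg≤outdeg+numArcs : outdeg T x ≤ outdeg T y + numArcs A'
  outdeg≤outdeg+numArcs = half-bound outdeg+indeg≤indeg+outdeg
    (suc-injective (trans (outdeg+indeg-tournament tournament x) (sym (outdeg+indeg-tournament tournament y))))

∣-∣≤ : ∀ {m n o} → m ≤ n + o → n ≤ m + o → ∣ m - n ∣ ≤ o
∣-∣≤ {m} {n} m≤n+o n≤m+o with ∣m-n∣≡[m∸n]∨[n∸m] m n
... | inj₁ eq = subst (_≤ _) (sym eq) (m≤n+o⇒m∸n≤o m n m≤n+o)
... | inj₂ eq = subst (_≤ _) (sym eq) (m≤n+o⇒m∸n≤o n m n≤m+o)

lemma3 : ∀ {n : ℕ} (T : Digraph n) (k : ℕ) (A' : Digraph n) →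
           IsTournament T → IsDESC T A' → numArcs A' ≤ k →
           ∀ (x y : Fin n) → sameComp (T -A A') x y ≡ true →
           ∣ outdeg T x - outdeg T y ∣ ≤ k
lemma3 T k A' tournament desc |A'|≤k x y x~y =
  ∣-∣≤ (outdeg≤outdeg+k x~y) (outdeg≤outdeg+k (sameComp-sym (T -A A') x~y))
  where
  outdeg≤outdeg+k : ∀ {u v} → sameComp (T -A A') u v ≡ true → outdeg T u ≤ outdeg T v + k
  outdeg≤outdeg+k {u} {v} u~v =
    ≤-trans (SameComponent.outdeg≤outdeg+numArcs T A' tournament desc u~v) (+-monoʳ-≤ (outdeg T v) |A'|≤k)
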